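{- Let $i\in\{0,1\}$ and let $\mathcal G=(V,\mathit{lab},\mathit{args},r,P)$ be a $\lambda$-ap-ho-term-graph over $\Sigma^\lambda_i$. Then: (i) If $v$ occurs in $P(w)$ (for $v,w\in V$), then: - $v\in V(\lambda)$, and $v$ occurs only once in $P(w)$; - every access path of $w$ passes through $v$ but does not end there, so $w\ne v$; - $P(v)v\le P(w)$. Conversely, if $P(w)=pvq$ for some $p,q\in V^*$, then $P(v)=p$. (ii) $P(w)\in V(\lambda)^*$ for all $w\in V$. (iii) $v$ does not occur in $P(v)$ for all $v\in V(\lambda)$. (iv) On every access path, every vertex other than the last one is labelled $\lambda$ or $@$. (The last vertex may be labelled $0$.)
   Context: Term graphs. A term graph over a signature $\Sigma$ is a tuple $(V,\mathit{lab},\mathit{args},r)$, where: - $\mathit{args}(v)\in V^*$ has length equal to the arity of $\mathit{lab}(v)$; - every vertex is reachable from the root $r$. Write $w\rightarrowtail_kw'$ if $w'$ is the $k$-th entry (from $0$) of $\mathit{args}(w)$. An access path of $w$ is a path $r=w_0\rightarrowtail\cdots\rightarrowtail w_n=w$ visiting no vertex twice. Notation. $\Sigma^\lambda_i=\{@,\lambda,0\}$ with arities $2,1,i$, and $V(\lambda)$ denotes the $\lambda$-labelled vertices. For words: $\epsilon$ is empty, juxtaposition is concatenation, $\le$ is the prefix order. $\lambda$-ap-ho-term-graphs. A $\lambda$-ap-ho-term-graph over $\Sigma^\lambda_i$ is $(V,\mathit{lab},\mathit{args},r,P)$ with $(V,\mathit{lab},\mathit{args},r)$ a term graph over $\Sigma^\lambda_i$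 and $P:V\to V^*$ satisfying, for all $w,w_0,w_1$ and $k\in\{0,1\}$: - $P(r)=\epsilon$; - $\mathit{lab}(w)=\lambda$ and $w\rightarrowtail_0w_0$ imply $P(w_0)\le P(w)w$; - $\mathit{lab}(w)=@$ and $w\rightarrowtail_kw_k$ imply $P(w_k)\le P(w)$; - $\mathit{lab}(w)=0$ implies $P(w)\ne\epsilon$; - $\mathit{lab}(w)=0$ and $w\rightarrowtail_0w_0$ imply $\mathit{lab}(w_0)=\lambda$ and $P(w_0)w_0=P(w)$. -}

module Defs where

open import Data.Nat using (ℕ; zero; suc)
open import Data.Fin using (Fin; toℕ)
open import Data.Vec using (Vec; lookup)
open import Data.List using (List; []; _∷_; _++_; [_])
open import Data.List.Membership.Propositional using (_∈_)
open import Data.List.Relation.Unary.All using (All)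
open import Data.Product using (Σ; ∃; _×_; _,_)
open import Data.Sum using (_⊎_)
open import Relation.Binary.PropositionalEquality using (_≡_; _≢_)
open import Relation.Binary.Construct.Closure.ReflexiveTransitive using (Star)

-- Labels of the signature Σ^λ_i = {@, λ, 0}
data Lab : Set where
  app lam var : Lab

arity : ℕ → Lab → ℕ
arity i app = 2
arity i lam = 1
arity i var = i

_≼_ : {A : Set} → List A → List A → Set
p ≼ q = ∃ λ s → p ++ s ≡ q

record TermGraph (i : ℕ) (V : Set) : Set where
  field
    lab  : V → Lab
    args : (v : V) → Vec V (arity i (lab v))
    root : V

  _↣[_]_ : V → ℕ → V → Set
  w ↣[ k ] w' = Σ (Fin (arity i (lab w))) λ j → toℕ j ≡ k × lookup (args w) j ≡ w'

  _↣_ : V → V → Set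
  w ↣ w' = ∃ λ k → w ↣[ k ] w'

  data Path : V → V → List V → Set where
    stop : ∀ {w} → Path w w [ w ]
    step : ∀ {u v w vs} → u ↣ v → Path v w vs → Path u w (u ∷ vs)

  NoRepeat : List V → Set
  NoRepeat vs = ∀ (v : V) (p q p' q' : List V) →
    vs ≡ p ++ v ∷ q → vs ≡ p' ++ v ∷ q' → p ≡ p'

  AccessPath : V → List V → Set
  AccessPath w vs = Path root w vs × NoRepeat vs

record IsTermGraph {i : ℕ} {V : Set} (G : TermGraph i V) : Set where
  open TermGraph G
  field
    reachable : ∀ (v : V) → Star _↣_ root v

record LamApHoTermGraph (i : ℕ) (V : Set) : Set₁ where
  field
    G   : TermGraph i V
    isG : IsTermGraph G
  open TermGraph G public
  field
    P : V → List V
    P-root : P root ≡ []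
    P-lam  : ∀ {w w₀} → lab w ≡ lam → w ↣[ 0 ] w₀ → P w₀ ≼ (P w ++ [ w ])
    P-app  : ∀ {w wₖ} (k : ℕ) → lab w ≡ app → w ↣[ k ] wₖ → P wₖ ≼ P w
    P-var  : ∀ {w} → lab w ≡ var → P w ≢ []
    P-var-bind : ∀ {w w₀} → lab w ≡ var → w ↣[ 0 ] w₀ →
                 lab w₀ ≡ lam × (P w₀ ++ [ w₀ ]) ≡ P w

-- Every edge u ↣ v satisfies P(v) ≼ P(u), or P(v) ≼ P(u)u when u is a λ; for a 0-vertex this
-- is because its binder v has P(v)v = P(u). Hence, from P(root) = ε, every property of the
-- lists P(w) that is closed under prefixes and under P(u) ↦ P(u)u for λ-vertices u holds for
-- all w. Two such properties are that P(w) consists of λ-vertices and that every entry x of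
-- P(w) is preceded exactly by P(x); the latter gives (i) and (iii). Along a path from the root
-- P(w) only grows by the vertices passed, so a vertex in P(w) lies on every access path of w.
-- Finally, a 0-vertex u followed on an access path by its binder v has v ∈ P(u), so v was
-- already visited before u, contradicting that access paths visit no vertex twice.
module Submission where

open import Defs
open import Data.Nat using (ℕ; _≤_; z≤n; s≤s)
open import Data.Nat.Properties using (n<1⇒n≡0; <-≤-trans)
open import Data.Fin.Properties using (toℕ<n)
open import Data.List using (List; []; _∷_; _++_; [_])
open import Data.List.Properties using (++-assoc; ∷-injective; ++-identityʳ-unique; ++-conicalʳ)
open import Data.List.Membership.Propositional using (_∈_; _∉_)
open import Data.List.Membership.Propositional.Properties using (∈-∃++; ∈-++⁺ˡ; ∈-++⁺ʳ; ∈-++⁻)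
open import Data.List.Relation.Unary.All as All using (All; []; _∷_)
open import Data.List.Relation.Unary.All.Properties using (++⁺; ++⁻ˡ)
open import Data.List.Relation.Unary.Any using (here; there)
open import Data.Product using (_×_; _,_; ∃; ∃₂; proj₂)
open import Data.Sum using (_⊎_; inj₁; inj₂)
open import Data.Empty using (⊥-elim)
open import Relation.Binary.PropositionalEquality using (_≡_; _≢_; refl; sym; trans; cong; subst)
open Relation.Binary.PropositionalEquality.≡-Reasoning
open import Relation.Binary.Construct.Closure.ReflexiveTransitive using (Star; ε; _◅_)
open import Relation.Nullary using (¬_)

module _ {A : Set} where

  ++-∷-≢ : (p : List A) {x : A} {q : List A} → p ≢ p ++ x ∷ q
  ++-∷-≢ p eq with () ← ++-identityʳ-unique p eq

  []≢++-∷ : (p : List A) {x : A} {q : List A} → [] ≢ p ++ x ∷ q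
  []≢++-∷ p eq with () ← ++-conicalʳ p _ (sym eq)

  ∷ʳ≡++-∷⁻ : (xs p : List A) {u x : A} {r : List A} → xs ++ [ u ] ≡ p ++ x ∷ r →
             (∃ λ r′ → xs ≡ p ++ x ∷ r′) ⊎ (xs ≡ p × u ≡ x)
  ∷ʳ≡++-∷⁻ []       []      refl = inj₂ (refl , refl)
  ∷ʳ≡++-∷⁻ []       (y ∷ p) eq   with () ← []≢++-∷ p (proj₂ (∷-injective eq))
  ∷ʳ≡++-∷⁻ (y ∷ xs) []      refl = inj₁ (xs , refl)
  ∷ʳ≡++-∷⁻ (y ∷ xs) (z ∷ p) eq   with refl , eq′ ← ∷-injective eq | ∷ʳ≡++-∷⁻ xs p eq′
  ... | inj₁ (r′ , xs≡)   = inj₁ (r′ , cong (y ∷_) xs≡)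
  ... | inj₂ (refl , u≡x) = inj₂ (refl , u≡x)

  All-from-splits : {S : A → Set} {xs : List A} →
                    (∀ a x c → xs ≡ a ++ x ∷ c → S x) → All S xs
  All-from-splits {xs = []}     _ = []
  All-from-splits {xs = x ∷ xs} h =
    h [] x xs refl ∷ All-from-splits (λ a y c eq → h (x ∷ a) y c (cong (x ∷_) eq))

module Properties {i : ℕ} (i≤1 : i ≤ 1) {V : Set} (H : LamApHoTermGraph i V) where
  open LamApHoTermGraph H

  ↣⇒↣[0] : ∀ {u v} → arity i (lab u) ≤ 1 → u ↣ v → u ↣[ 0 ] v
  ↣⇒↣[0] unary (_ , j , _ , lj) = j , n<1⇒n≡0 (<-≤-trans (toℕ<n j) unary) , lj

  arity-lam : ∀ {u} → lab u ≡ lam → arity i (lab u) ≤ 1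
  arity-lam e rewrite e = s≤s z≤n

  arity-var : ∀ {u} → lab u ≡ var → arity i (lab u) ≤ 1
  arity-var e rewrite e = i≤1

  P-edge : ∀ {u v} → u ↣ v → P v ≼ P u ⊎ (lab u ≡ lam × P v ≼ (P u ++ [ u ]))
  P-edge {u} {v} e@(k , e[k]) = by-label (lab u) refl
    where
    by-label : ∀ l → lab u ≡ l → P v ≼ P u ⊎ (lab u ≡ lam × P v ≼ (P u ++ [ u ]))
    by-label app eq = inj₁ (P-app k eq e[k])
    by-label lam eq = inj₂ (eq , P-lam eq (↣⇒↣[0] (arity-lam eq) e))
    by-label var eq = inj₁ ([ v ] , proj₂ (P-var-bind eq (↣⇒↣[0] (arity-var eq) e)))

  var-binder∈P : ∀ {u v} → lab u ≡ var → u ↣ v → v ∈ P u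
  var-binder∈P {v = v} eq e =
    subst (v ∈_) (proj₂ (P-var-bind eq (↣⇒↣[0] (arity-var eq) e)))
          (∈-++⁺ʳ (P v) (here refl))

  P-edge-⊆ : ∀ {u v x} → u ↣ v → x ∈ P v → x ∈ P u ⊎ x ≡ u
  P-edge-⊆ {x = x} e x∈ with P-edge e
  ... | inj₁ (s , eq) = inj₁ (subst (x ∈_) eq (∈-++⁺ˡ x∈))
  ... | inj₂ (_ , s , eq) with ∈-++⁻ (P _) (subst (x ∈_) eq (∈-++⁺ˡ x∈))
  ...   | inj₁ x∈Pu       = inj₁ x∈Pu
  ...   | inj₂ (here x≡u) = inj₂ x≡u

  P-invariant : (S : List V → Set) → S [] →
                (∀ {ws ws′} → ws ≼ ws′ → S ws′ → S ws) →
                (∀ {u} → lab u ≡ lam → S (P u) → S (P u ++ [ u ])) →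
                ∀ w → S (P w)
  P-invariant S S[] S-prefix S-snoc w =
    along (IsTermGraph.reachable isG w) (subst S (sym P-root) S[])
    where
    along : ∀ {u w} → Star _↣_ u w → S (P u) → S (P w)
    along ε           Su = Su
    along (e ◅ steps) Su with P-edge e
    ... | inj₁ v≼u        = along steps (S-prefix v≼u Su)
    ... | inj₂ (λu , v≼u) = along steps (S-prefix v≼u (S-snoc λu Su))

  All-lam-P : ∀ w → All (λ u → lab u ≡ lam) (P w)
  All-lam-P = P-invariant (All _) []
    (λ { (_ , refl) → ++⁻ˡ _ })
    (λ λu all → ++⁺ all (λu ∷ []))

  Coherent : List V → Set
  Coherent ws = ∀ p x q → ws ≡ p ++ x ∷ q → P x ≡ p

  Coherent-P : ∀ w → Coherent (P w)
  Coherent-P = P-invariant Coherent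
    (λ p _ _ eq → ⊥-elim ([]≢++-∷ p eq))
    (λ { (s , refl) coh p x q eq → coh p x (q ++ s) (trans (cong (_++ s) eq) (++-assoc p _ s)) })
    snoc
    where
    snoc : ∀ {u} → lab u ≡ lam → Coherent (P u) → Coherent (P u ++ [ u ])
    snoc {u} _ coh p x q eq with ∷ʳ≡++-∷⁻ (P u) p eq
    ... | inj₁ (r , Pu≡)     = coh p x r Pu≡
    ... | inj₂ (Pu≡p , refl) = Pu≡p

  ∉-P-self : ∀ v → v ∉ P v
  ∉-P-self v v∈ with a , b , eq ← ∈-∃++ v∈ = ++-∷-≢ a (trans (sym (Coherent-P v a v b eq)) eq)

  P-∷ʳ-≼ : ∀ {v w} → v ∈ P w → (P v ++ [ v ]) ≼ P w
  P-∷ʳ-≼ {v} {w} v∈ with a , b , eq ← ∈-∃++ v∈ rewrite Coherent-P w a v b eq =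
    b , trans (++-assoc a [ v ] b) (sym eq)

  P⊆Path : ∀ {u w vs x} → Path u w vs → x ∈ P w → x ∈ P u ⊎ x ∈ vs
  P⊆Path stop          x∈ = inj₁ x∈
  P⊆Path (step e path) x∈ with P⊆Path path x∈
  ... | inj₂ x∈vs = inj₂ (there x∈vs)
  ... | inj₁ x∈Pv with P-edge-⊆ e x∈Pv
  ...   | inj₁ x∈Pu = inj₁ x∈Pu
  ...   | inj₂ refl = inj₂ (here refl)

  P⊆Path-root : ∀ {w vs x} → Path root w vs → x ∈ P w → x ∈ vs
  P⊆Path-root path x∈ with P⊆Path path x∈
  ... | inj₂ x∈vs = x∈vs
  ... | inj₁ x∈Pr with () ← subst (_ ∈_) P-root x∈Pr

  Path-head : ∀ {u w x vs} → Path u w (x ∷ vs) → u ≡ x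
  Path-head stop       = refl
  Path-head (step _ _) = refl

  Path-split : ∀ {u w vs} (a : List V) {x y b} → Path u w vs → vs ≡ a ++ x ∷ y ∷ b →
               Path u x (a ++ [ x ]) × x ↣ y
  Path-split []      stop          ()
  Path-split []      (step e path) refl with refl ← Path-head path = stop , e
  Path-split (_ ∷ a) stop          eq   with () ← []≢++-∷ a (proj₂ (∷-injective eq))
  Path-split (_ ∷ a) (step e path) refl with prefix , e′ ← Path-split a path refl =
    step e prefix , e′

  ¬NoRepeat-++-∷ : ∀ {y} (a : List V) {b} → y ∈ a → ¬ NoRepeat (a ++ y ∷ b)
  ¬NoRepeat-++-∷ {y} a {b} y∈ nr with a₁ , a₂ , refl ← ∈-∃++ y∈ =
    ++-∷-≢ a₁ (nr y a₁ (a₂ ++ y ∷ b) (a₁ ++ y ∷ a₂) b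
                  (++-assoc a₁ (y ∷ a₂) (y ∷ b)) refl)

  AccessPath-inner-lam-or-app : ∀ {w vs ys} → AccessPath w vs → vs ≡ ys ++ [ w ] →
                                All (λ u → lab u ≡ lam ⊎ lab u ≡ app) ys
  AccessPath-inner-lam-or-app {w} {vs} {ys} (path , nr) vs≡ = All-from-splits inner
    where
    classify : ∀ a {u y b} → vs ≡ a ++ u ∷ y ∷ b → lab u ≡ lam ⊎ lab u ≡ app
    classify a {u} {y} {b} eq with lab u in lu
    ... | lam = inj₁ refl
    ... | app = inj₂ refl
    ... | var with prefix , u↣y ← Path-split a path eq =
      ⊥-elim (¬NoRepeat-++-∷ (a ++ [ u ]) (P⊆Path-root prefix (var-binder∈P lu u↣y))
                             (subst NoRepeat (trans eq (sym (++-assoc a [ u ] (y ∷ b)))) nr))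

    next : ∀ c → ∃₂ λ y b → c ++ [ w ] ≡ y ∷ b
    next []      = w , [] , refl
    next (y ∷ c) = y , c ++ [ w ] , refl

    inner : ∀ a u c → ys ≡ a ++ u ∷ c → lab u ≡ lam ⊎ lab u ≡ app
    inner a u c ys≡ with y , b , c≡ ← next c = classify a (begin
      vs                    ≡⟨ vs≡ ⟩
      ys ++ [ w ]           ≡⟨ cong (_++ [ w ]) ys≡ ⟩
      (a ++ u ∷ c) ++ [ w ] ≡⟨ ++-assoc a (u ∷ c) [ w ] ⟩
      a ++ u ∷ c ++ [ w ]   ≡⟨ cong (λ t → a ++ u ∷ t) c≡ ⟩
      a ++ u ∷ y ∷ b        ∎)

lemma4p3 : (i : ℕ) → i ≤ 1 → (V : Set) → (H : LamApHoTermGraph i V) →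
    (((v w : V) → v ∈ LamApHoTermGraph.P H w →
        (LamApHoTermGraph.lab H v ≡ lam)
        × ((p q p' q' : List V) → LamApHoTermGraph.P H w ≡ p ++ v ∷ q → LamApHoTermGraph.P H w ≡ p' ++ v ∷ q' → p ≡ p')
        × ((vs : List V) → LamApHoTermGraph.AccessPath H w vs → (v ∈ vs) × (w ≢ v))
        × ((LamApHoTermGraph.P H v ++ [ v ]) ≼ LamApHoTermGraph.P H w))
     × ((v w : V) (p q : List V) → LamApHoTermGraph.P H w ≡ p ++ v ∷ q → LamApHoTermGraph.P H v ≡ p))
    × ((w : V) → All (λ u → LamApHoTermGraph.lab H u ≡ lam) (LamApHoTermGraph.P H w))
    × ((v : V) → LamApHoTermGraph.lab H v ≡ lam → v ∉ LamApHoTermGraph.P H v)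
    × ((w : V) (vs ys : List V) → LamApHoTermGraph.AccessPath H w vs → vs ≡ ys ++ [ w ] →
        All (λ u → LamApHoTermGraph.lab H u ≡ lam ⊎ LamApHoTermGraph.lab H u ≡ app) ys)
lemma4p3 i i≤1 V H =
  ( (λ v w v∈ →
        All.lookup (All-lam-P w) v∈
      , (λ p q p′ q′ eq eq′ → trans (sym (Coherent-P w p v q eq)) (Coherent-P w p′ v q′ eq′))
      , (λ vs (path , _) → P⊆Path-root path v∈ , λ { refl → ∉-P-self v v∈ })
      , P-∷ʳ-≼ v∈)
  , (λ v w p q → Coherent-P w p v q))
  , All-lam-P
  , (λ v _ → ∉-P-self v)
  , (λ w vs ys → AccessPath-inner-lam-or-app)
  where
  open LamApHoTermGraph H
  open Properties i≤1 H
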